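{- Let $S$ be a modal Kleene algebra and $a,b\in S$ with $a$ Noetherian. The following are equivalent: (1) $a$ locally d-semi-commutes over $b$: $|b\rangle|a\rangle\le|a^+\rangle|b^*\rangle$; (2) $a$ d-semi-commutes over $b$: $|b^*\rangle|a\rangle\le|a^+\rangle|b^*\rangle$; (3) $a$ d-quasi-commutes over $b$: $|b\rangle|a\rangle\le|a\rangle|(a+b)^*\rangle$.
   Context: An idempotent semiring is a structure $(S,+,\cdot,0,1)$ such that $(S,+,0)$ is a commutative monoid with $a+a=a$, $(S,\cdot,1)$ is a monoid, multiplication distributes over addition from both sides, and $0a=a0=0$; natural order $a\le b\iff a+b=b$. A test is an element $p\le 1$ for which some $q$ satisfies $p+q=1$ and $pq=0=qp$; $q$ is unique, written $\neg p$; tests form a Boolean algebra $\mathrm{test}(S)$; $p-q=p\cdot\neg q$. $S$ is a modal semiring if for each $a\in S$ there are maps $|a\rangle,\langle a|$ on $\mathrm{test}(S)$ with, for all $a,b,p,q$: $|a\rangle p\le q\iff \neg q\,a\,p\le 0$; $\langle a|p\le q\iff p\,a\,\neg q\le 0$; $|ab\rangle p=|a\rangle(|b\rangle p)$; $\langle ab|p=\langle b|(\langle a|p)$. Maps on tests are ordered pointwise, juxtaposition is composition. A Kleene algebra is an idempotent semiring with ${}^*$ such that $1+aa^*\le a^*$, $b+ac\le c\Rightarrow a^*b\le c$, $1+a^*a\le a^*$, $b+ca\le c\Rightarrow ba^*\le c$; $a^+=aa^*$; a modal Kleene algebra is a Kleene algebra that is a modal semiring. $a$ is Noetherian if for all tests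 $p$, $p-|a\rangle p\le 0$ implies $p\le 0$. -}

module Defs where

open import Level using (Level; suc; _⊔_)
open import Data.Product using (Σ; _×_; _,_; proj₁; proj₂)
open import Relation.Binary.PropositionalEquality using (_≡_)

record ModalKleeneAlgebra (c : Level) : Set (suc c) where
  infixl 6 _+_
  infixl 7 _·_
  infix 4 _≤_
  field
    Carrier : Set c
    _+_     : Carrier → Carrier → Carrier
    _·_     : Carrier → Carrier → Carrier
    0#      : Carrier
    1#      : Carrier
    _⋆      : Carrier → Carrier

  _≤_ : Carrier → Carrier → Set c
  a ≤ b = a + b ≡ b

  -- tests: p ≤ 1 with a complement q; the complement is unique,
  -- so carrying it as a witness determines ¬ p.
  IsTest : Carrier → Set c
  IsTest p = (p ≤ 1#) × Σ Carrier (λ q → (p + q ≡ 1#) × (p · q ≡ 0#) × (q · p ≡ 0#))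

  Test : Set c
  Test = Σ Carrier IsTest

  ⌊_⌋ : Test → Carrier
  ⌊ t ⌋ = proj₁ t

  ¬ₜ : Test → Carrier
  ¬ₜ t = proj₁ (proj₂ (proj₂ t))

  field
    +-assoc   : ∀ a b c → (a + b) + c ≡ a + (b + c)
    +-comm    : ∀ a b → a + b ≡ b + a
    +-identityˡ : ∀ a → 0# + a ≡ a
    +-idem    : ∀ a → a + a ≡ a
    ·-assoc   : ∀ a b c → (a · b) · c ≡ a · (b · c)
    ·-identityˡ : ∀ a → 1# · a ≡ a
    ·-identityʳ : ∀ a → a · 1# ≡ a
    distribˡ  : ∀ a b c → a · (b + c) ≡ a · b + a · c
    distribʳ  : ∀ a b c → (b + c) · a ≡ b · a + c · a
    zeroˡ     : ∀ a → 0# · a ≡ 0#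
    zeroʳ     : ∀ a → a · 0# ≡ 0#
    ⋆-unfoldˡ : ∀ a → 1# + a · (a ⋆) ≤ a ⋆
    ⋆-inductˡ : ∀ a b c → b + a · c ≤ c → (a ⋆) · b ≤ c
    ⋆-unfoldʳ : ∀ a → 1# + (a ⋆) · a ≤ a ⋆
    ⋆-inductʳ : ∀ a b c → b + c · a ≤ c → b · (a ⋆) ≤ c
    fdia : Carrier → Test → Test
    bdia : Carrier → Test → Test
    fdia-galois : ∀ a p q →
      ((⌊ fdia a p ⌋ ≤ ⌊ q ⌋ → ¬ₜ q · a · ⌊ p ⌋ ≤ 0#) ×
       (¬ₜ q · a · ⌊ p ⌋ ≤ 0# → ⌊ fdia a p ⌋ ≤ ⌊ q ⌋))
    bdia-galois : ∀ a p q →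
      ((⌊ bdia a p ⌋ ≤ ⌊ q ⌋ → ⌊ p ⌋ · a · ¬ₜ q ≤ 0#) ×
       (⌊ p ⌋ · a · ¬ₜ q ≤ 0# → ⌊ bdia a p ⌋ ≤ ⌊ q ⌋))
    fdia-comp : ∀ a b p → fdia (a · b) p ≡ fdia a (fdia b p)
    bdia-comp : ∀ a b p → bdia (a · b) p ≡ bdia b (bdia a p)

  _⁺ : Carrier → Carrier
  a ⁺ = a · (a ⋆)

  _-ₜ_ : Test → Test → Carrier
  p -ₜ q = ⌊ p ⌋ · ¬ₜ q

  _≤ᶠ_ : (Test → Test) → (Test → Test) → Set c
  f ≤ᶠ g = ∀ p → ⌊ f p ⌋ ≤ ⌊ g p ⌋

  ∣_⟩ : Carrier → Test → Test
  ∣ a ⟩ = fdia a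

  Noetherian : Carrier → Set c
  Noetherian a = ∀ (p : Test) → p -ₜ fdia a p ≤ 0# → ⌊ p ⌋ ≤ 0#

  -- juxtaposition of maps = composition
  LocallyDSemiCommutes : Carrier → Carrier → Set c
  LocallyDSemiCommutes a b = (λ p → ∣ b ⟩ (∣ a ⟩ p)) ≤ᶠ (λ p → ∣ a ⁺ ⟩ (∣ b ⋆ ⟩ p))

  DSemiCommutes : Carrier → Carrier → Set c
  DSemiCommutes a b = (λ p → ∣ b ⋆ ⟩ (∣ a ⟩ p)) ≤ᶠ (λ p → ∣ a ⁺ ⟩ (∣ b ⋆ ⟩ p))

  DQuasiCommutes : Carrier → Carrier → Set c
  DQuasiCommutes a b = (λ p → ∣ b ⟩ (∣ a ⟩ p)) ≤ᶠ (λ p → ∣ a ⟩ (∣ (a + b) ⋆ ⟩ p))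

_⇔_ : ∀ {a b} → Set a → Set b → Set (a ⊔ b)
A ⇔ B = (A → B) × (B → A)

module Submission where

-- The one place
-- where Noetherianity enters is a Noetherian induction principle: if
-- q ≤ r + |a⟩q and r is |a⟩-closed, then q ≤ r, because the test q - r
-- satisfies q - r ≤ |a⟩(q - r) and must therefore vanish.
--
-- The implications (2) ⇒ (1) (b ≤ b*) and (1) ⇒ (3) (a*b* ≤ (a+b)*) are
-- direct.  For (3) ⇒ (2), star induction gives |b*⟩|a⟩ ≤ |a⟩|(a+b)*⟩, and
-- (3) also gives |(a+b)*⟩p ≤ |b*⟩p + |a⟩|(a+b)*⟩p; Noetherian induction then
-- yields |(a+b)*⟩ ≤ |a*⟩|b*⟩, so |b*⟩|a⟩ ≤ |a⟩|a*⟩|b*⟩ = |a⁺⟩|b*⟩.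

open import Defs
open import Level using (Level)
open import Data.Product using (_×_; _,_; proj₁; proj₂)
open import Relation.Binary.PropositionalEquality as ≡ using (_≡_; sym; trans; cong; subst)
open import Relation.Binary.Bundles using (Poset)
import Relation.Binary.Reasoning.PartialOrder as PosetReasoning

module Properties {c : Level} (S : ModalKleeneAlgebra c) where
  open ModalKleeneAlgebra S

  +-identityʳ : ∀ x → x + 0# ≡ x
  +-identityʳ x = trans (+-comm x 0#) (+-identityˡ x)

  ≡⇒≤ : ∀ {x y} → x ≡ y → x ≤ y
  ≡⇒≤ {x} eq = subst (x ≤_) eq (+-idem x)

  ≤-refl : ∀ {x} → x ≤ x
  ≤-refl {x} = +-idem x

  ≤-trans : ∀ {x y z} → x ≤ y → y ≤ z → x ≤ z
  ≤-trans {x} {y} {z} x≤y y≤z = begin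
    x + z       ≡⟨ cong (x +_) (sym y≤z) ⟩
    x + (y + z) ≡⟨ sym (+-assoc x y z) ⟩
    (x + y) + z ≡⟨ cong (_+ z) x≤y ⟩
    y + z       ≡⟨ y≤z ⟩
    z           ∎
    where open ≡.≡-Reasoning

  ≤-antisym : ∀ {x y} → x ≤ y → y ≤ x → x ≡ y
  ≤-antisym {x} {y} x≤y y≤x = trans (sym y≤x) (trans (+-comm y x) x≤y)

  ≤-poset : Poset c c c
  ≤-poset = record
    { _≈_ = _≡_
    ; _≤_ = _≤_
    ; isPartialOrder = record
      { isPreorder = record
        { isEquivalence = ≡.isEquivalence
        ; reflexive = ≡⇒≤
        ; trans = ≤-trans
        }
      ; antisym = ≤-antisym
      }
    }

  module ≤-Reasoning = PosetReasoning ≤-poset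

  x≤x+y : ∀ x y → x ≤ x + y
  x≤x+y x y = trans (sym (+-assoc x x y)) (cong (_+ y) (+-idem x))

  y≤x+y : ∀ x y → y ≤ x + y
  y≤x+y x y = subst (y ≤_) (+-comm y x) (x≤x+y y x)

  +-lub : ∀ {x y z} → x ≤ z → y ≤ z → x + y ≤ z
  +-lub {x} {y} {z} x≤z y≤z = trans (+-assoc x y z) (trans (cong (x +_) y≤z) x≤z)

  +-mono : ∀ {x x′ y y′} → x ≤ x′ → y ≤ y′ → x + y ≤ x′ + y′
  +-mono {x′ = x′} {y′ = y′} x≤x′ y≤y′ =
    +-lub (≤-trans x≤x′ (x≤x+y x′ y′)) (≤-trans y≤y′ (y≤x+y x′ y′))

  ≤0⇒≡0 : ∀ {x} → x ≤ 0# → x ≡ 0#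
  ≤0⇒≡0 {x} x≤0 = trans (sym (+-identityʳ x)) x≤0

  ·-monoʳ : ∀ x {y z} → y ≤ z → x · y ≤ x · z
  ·-monoʳ x {y} {z} y≤z = trans (sym (distribˡ x y z)) (cong (x ·_) y≤z)

  ·-monoˡ : ∀ x {y z} → y ≤ z → y · x ≤ z · x
  ·-monoˡ x {y} {z} y≤z = trans (sym (distribʳ x y z)) (cong (_· x) y≤z)

  ·-decreasingˡ : ∀ {t} y → t ≤ 1# → t · y ≤ y
  ·-decreasingˡ {t} y t≤1 = subst (t · y ≤_) (·-identityˡ y) (·-monoˡ y t≤1)

  ·-decreasingʳ : ∀ {t} y → t ≤ 1# → y · t ≤ y
  ·-decreasingʳ {t} y t≤1 = subst (y · t ≤_) (·-identityʳ y) (·-monoʳ y t≤1)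

  1≤⋆ : ∀ x → 1# ≤ x ⋆
  1≤⋆ x = ≤-trans (x≤x+y 1# (x · x ⋆)) (⋆-unfoldˡ x)

  x⋆≤⋆ : ∀ x → x · x ⋆ ≤ x ⋆
  x⋆≤⋆ x = ≤-trans (y≤x+y 1# (x · x ⋆)) (⋆-unfoldˡ x)

  ⋆x≤⋆ : ∀ x → x ⋆ · x ≤ x ⋆
  ⋆x≤⋆ x = ≤-trans (y≤x+y 1# (x ⋆ · x)) (⋆-unfoldʳ x)

  x≤⋆ : ∀ x → x ≤ x ⋆
  x≤⋆ x = ≤-trans (subst (_≤ x · x ⋆) (·-identityʳ x) (·-monoʳ x (1≤⋆ x))) (x⋆≤⋆ x)

  ⋆-simulation : ∀ x y → y · x ≤ x · y → y · x ⋆ ≤ x ⋆ · y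
  ⋆-simulation x y yx≤xy = ⋆-inductʳ x y (x ⋆ · y) (+-lub y≤x⋆y x⋆yx≤x⋆y)
    where
    open ≤-Reasoning
    y≤x⋆y : y ≤ x ⋆ · y
    y≤x⋆y = subst (_≤ x ⋆ · y) (·-identityˡ y) (·-monoˡ y (1≤⋆ x))
    x⋆yx≤x⋆y : x ⋆ · y · x ≤ x ⋆ · y
    x⋆yx≤x⋆y = begin
      x ⋆ · y · x   ≡⟨ ·-assoc (x ⋆) y x ⟩
      x ⋆ · (y · x) ≤⟨ ·-monoʳ (x ⋆) yx≤xy ⟩
      x ⋆ · (x · y) ≡⟨ sym (·-assoc (x ⋆) x y) ⟩
      x ⋆ · x · y   ≤⟨ ·-monoˡ y (⋆x≤⋆ x) ⟩
      x ⋆ · y       ∎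

  test≤1 : (t : Test) → ⌊ t ⌋ ≤ 1#
  test≤1 t = proj₁ (proj₂ t)

  test+¬test : (t : Test) → ⌊ t ⌋ + ¬ₜ t ≡ 1#
  test+¬test t = proj₁ (proj₂ (proj₂ (proj₂ t)))

  test·¬test : (t : Test) → ⌊ t ⌋ · ¬ₜ t ≡ 0#
  test·¬test t = proj₁ (proj₂ (proj₂ (proj₂ (proj₂ t))))

  ¬test·test : (t : Test) → ¬ₜ t · ⌊ t ⌋ ≡ 0#
  ¬test·test t = proj₂ (proj₂ (proj₂ (proj₂ (proj₂ t))))

  ¬test≤1 : (t : Test) → ¬ₜ t ≤ 1#
  ¬test≤1 t = subst (¬ₜ t ≤_) (test+¬test t) (y≤x+y ⌊ t ⌋ (¬ₜ t))

  splitʳ : (t : Test) → ∀ y → y ≡ y · ⌊ t ⌋ + y · ¬ₜ t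
  splitʳ t y = begin
    y                    ≡⟨ sym (·-identityʳ y) ⟩
    y · 1#               ≡⟨ cong (y ·_) (sym (test+¬test t)) ⟩
    y · (⌊ t ⌋ + ¬ₜ t)   ≡⟨ distribˡ y _ _ ⟩
    y · ⌊ t ⌋ + y · ¬ₜ t ∎
    where open ≡.≡-Reasoning

  splitˡ : (t : Test) → ∀ y → y ≡ ⌊ t ⌋ · y + ¬ₜ t · y
  splitˡ t y = begin
    y                    ≡⟨ sym (·-identityˡ y) ⟩
    1# · y               ≡⟨ cong (_· y) (sym (test+¬test t)) ⟩
    (⌊ t ⌋ + ¬ₜ t) · y   ≡⟨ distribʳ y _ _ ⟩
    ⌊ t ⌋ · y + ¬ₜ t · y ∎
    where open ≡.≡-Reasoning

  below-testʳ : (q : Test) → ∀ {y} → y ≤ 1# → y · ¬ₜ q ≤ 0# → y ≤ ⌊ q ⌋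
  below-testʳ q {y} y≤1 y¬q≤0 = subst (_≤ ⌊ q ⌋) (sym y≡yq) (·-decreasingˡ ⌊ q ⌋ y≤1)
    where
    y≡yq : y ≡ y · ⌊ q ⌋
    y≡yq = trans (splitʳ q y)
             (trans (cong (y · ⌊ q ⌋ +_) (≤0⇒≡0 y¬q≤0)) (+-identityʳ _))

  below-testˡ : (q : Test) → ∀ {y} → y ≤ 1# → ¬ₜ q · y ≤ 0# → y ≤ ⌊ q ⌋
  below-testˡ q {y} y≤1 ¬qy≤0 = subst (_≤ ⌊ q ⌋) (sym y≡qy) (·-decreasingʳ ⌊ q ⌋ y≤1)
    where
    y≡qy : y ≡ ⌊ q ⌋ · y
    y≡qy = trans (splitˡ q y)
             (trans (cong (⌊ q ⌋ · y +_) (≤0⇒≡0 ¬qy≤0)) (+-identityʳ _))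

  annihilateʳ : (q : Test) → ∀ {y} → y ≤ ⌊ q ⌋ → y · ¬ₜ q ≤ 0#
  annihilateʳ q y≤q = ≤-trans (·-monoˡ (¬ₜ q) y≤q) (≡⇒≤ (test·¬test q))

  annihilateˡ : (q : Test) → ∀ {y} → y ≤ ⌊ q ⌋ → ¬ₜ q · y ≤ 0#
  annihilateˡ q y≤q = ≤-trans (·-monoʳ (¬ₜ q) y≤q) (≡⇒≤ (¬test·test q))

  ∁ : Test → Test
  ∁ t = ¬ₜ t , ¬test≤1 t , ⌊ t ⌋ , trans (+-comm (¬ₜ t) ⌊ t ⌋) (test+¬test t)
              , ¬test·test t , test·¬test t

  infixl 6 _⊕_
  _⊕_ : Test → Test → Test
  p ⊕ q = P + Q , +-lub (test≤1 p) (test≤1 q) , ¬P · ¬Q , cover , disjointʳ , disjointˡ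
    where
    P = ⌊ p ⌋
    Q = ⌊ q ⌋
    ¬P = ¬ₜ p
    ¬Q = ¬ₜ q
    open ≤-Reasoning
    cover : (P + Q) + ¬P · ¬Q ≡ 1#
    cover = ≤-antisym
      (+-lub (+-lub (test≤1 p) (test≤1 q)) (≤-trans (·-decreasingʳ ¬P (¬test≤1 q)) (¬test≤1 p)))
      (begin
        1#                        ≡⟨ sym (test+¬test p) ⟩
        P + ¬P                    ≡⟨ cong (P +_) (splitʳ q ¬P) ⟩
        P + (¬P · Q + ¬P · ¬Q)    ≤⟨ +-mono ≤-refl (+-mono (·-decreasingˡ Q (¬test≤1 p)) ≤-refl) ⟩
        P + (Q + ¬P · ¬Q)         ≡⟨ sym (+-assoc P Q (¬P · ¬Q)) ⟩
        (P + Q) + ¬P · ¬Q         ∎)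
    disjointʳ : (P + Q) · (¬P · ¬Q) ≡ 0#
    disjointʳ = ≤0⇒≡0 (begin
      (P + Q) · (¬P · ¬Q)              ≡⟨ distribʳ (¬P · ¬Q) P Q ⟩
      P · (¬P · ¬Q) + Q · (¬P · ¬Q)    ≤⟨ +-mono (≡⇒≤ (sym (·-assoc P ¬P ¬Q)))
                                                 (·-monoʳ Q (·-decreasingˡ ¬Q (¬test≤1 p))) ⟩
      P · ¬P · ¬Q + Q · ¬Q             ≡⟨ ≡.cong₂ (λ u v → u · ¬Q + v) (test·¬test p) (test·¬test q) ⟩
      0# · ¬Q + 0#                     ≡⟨ trans (+-identityʳ _) (zeroˡ ¬Q) ⟩
      0#                               ∎)
    disjointˡ : (¬P · ¬Q) · (P + Q) ≡ 0#
    disjointˡ = ≤0⇒≡0 (begin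
      (¬P · ¬Q) · (P + Q)              ≡⟨ distribˡ (¬P · ¬Q) P Q ⟩
      ¬P · ¬Q · P + ¬P · ¬Q · Q        ≤⟨ +-mono (·-monoˡ P (·-decreasingʳ ¬P (¬test≤1 q)))
                                                 (≡⇒≤ (·-assoc ¬P ¬Q Q)) ⟩
      ¬P · P + ¬P · (¬Q · Q)           ≡⟨ ≡.cong₂ (λ u v → u + ¬P · v) (¬test·test p) (¬test·test q) ⟩
      0# + ¬P · 0#                     ≡⟨ trans (+-identityˡ _) (zeroʳ ¬P) ⟩
      0#                               ∎)

  -- The relative complement p - q as a test: ⌊ p ∖ q ⌋ is p -ₜ q by definition.
  _∖_ : Test → Test → Test
  p ∖ q = ∁ (∁ p ⊕ q)

  test-split : (q r : Test) → ⌊ q ⌋ ≤ ⌊ q ∖ r ⌋ + ⌊ r ⌋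
  test-split q r = begin
    ⌊ q ⌋                            ≡⟨ splitʳ r ⌊ q ⌋ ⟩
    ⌊ q ⌋ · ⌊ r ⌋ + ⌊ q ⌋ · ¬ₜ r     ≤⟨ +-mono (·-decreasingˡ ⌊ r ⌋ (test≤1 q)) ≤-refl ⟩
    ⌊ r ⌋ + ⌊ q ∖ r ⌋                ≡⟨ +-comm ⌊ r ⌋ _ ⟩
    ⌊ q ∖ r ⌋ + ⌊ r ⌋                ∎
    where open ≤-Reasoning

  complement-shift : (r : Test) → ∀ {x y} → y ≤ x + ⌊ r ⌋ → y · ¬ₜ r ≤ x
  complement-shift r {x} {y} y≤x+r = begin
    y · ¬ₜ r                     ≤⟨ ·-monoˡ (¬ₜ r) y≤x+r ⟩
    (x + ⌊ r ⌋) · ¬ₜ r           ≡⟨ distribʳ (¬ₜ r) x ⌊ r ⌋ ⟩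
    x · ¬ₜ r + ⌊ r ⌋ · ¬ₜ r      ≡⟨ cong (x · ¬ₜ r +_) (test·¬test r) ⟩
    x · ¬ₜ r + 0#                ≡⟨ +-identityʳ _ ⟩
    x · ¬ₜ r                     ≤⟨ ·-decreasingʳ x (¬test≤1 r) ⟩
    x                            ∎
    where open ≤-Reasoning

  dia : Carrier → Test → Carrier
  dia x p = ⌊ fdia x p ⌋

  dia-galois⇒ : ∀ x p q → dia x p ≤ ⌊ q ⌋ → ¬ₜ q · x · ⌊ p ⌋ ≤ 0#
  dia-galois⇒ x p q = proj₁ (fdia-galois x p q)

  dia-galois⇐ : ∀ x p q → ¬ₜ q · x · ⌊ p ⌋ ≤ 0# → dia x p ≤ ⌊ q ⌋
  dia-galois⇐ x p q = proj₂ (fdia-galois x p q)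

  dia-unit : ∀ x p → ¬ₜ (fdia x p) · x · ⌊ p ⌋ ≤ 0#
  dia-unit x p = dia-galois⇒ x p (fdia x p) ≤-refl

  dia-monoʳ : ∀ x {p q} → ⌊ p ⌋ ≤ ⌊ q ⌋ → dia x p ≤ dia x q
  dia-monoʳ x {p} {q} p≤q =
    dia-galois⇐ x p (fdia x q) (≤-trans (·-monoʳ _ p≤q) (dia-unit x q))

  dia-monoˡ : ∀ {x y} p → x ≤ y → dia x p ≤ dia y p
  dia-monoˡ {x} {y} p x≤y = dia-galois⇐ x p (fdia y p)
    (≤-trans (·-monoˡ ⌊ p ⌋ (·-monoʳ (¬ₜ (fdia y p)) x≤y)) (dia-unit y p))

  dia-+-lub : ∀ x y p r → dia x p ≤ ⌊ r ⌋ → dia y p ≤ ⌊ r ⌋ → dia (x + y) p ≤ ⌊ r ⌋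
  dia-+-lub x y p r x≤r y≤r = dia-galois⇐ (x + y) p r
    (subst (_≤ 0#) (sym (trans (cong (_· ⌊ p ⌋) (distribˡ (¬ₜ r) x y)) (distribʳ ⌊ p ⌋ _ _)))
      (+-lub (dia-galois⇒ x p r x≤r) (dia-galois⇒ y p r y≤r)))

  dia-⊕-lub : ∀ x p q r → dia x p ≤ ⌊ r ⌋ → dia x q ≤ ⌊ r ⌋ → dia x (p ⊕ q) ≤ ⌊ r ⌋
  dia-⊕-lub x p q r p≤r q≤r = dia-galois⇐ x (p ⊕ q) r
    (subst (_≤ 0#) (sym (distribˡ (¬ₜ r · x) ⌊ p ⌋ ⌊ q ⌋))
      (+-lub (dia-galois⇒ x p r p≤r) (dia-galois⇒ x q r q≤r)))

  dia-comp : ∀ x y p → dia (x · y) p ≡ dia x (fdia y p)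
  dia-comp x y p = cong proj₁ (fdia-comp x y p)

  dia-1 : ∀ p → ⌊ p ⌋ ≤ dia 1# p
  dia-1 p = below-testˡ (fdia 1# p) (test≤1 p)
    (subst (λ z → z · ⌊ p ⌋ ≤ 0#) (·-identityʳ _) (dia-unit 1# p))

  dia-⋆-refl : ∀ x p → ⌊ p ⌋ ≤ dia (x ⋆) p
  dia-⋆-refl x p = ≤-trans (dia-1 p) (dia-monoˡ p (1≤⋆ x))

  dia-⋆-closed : ∀ {x y} p → y ≤ x → dia y (fdia (x ⋆) p) ≤ dia (x ⋆) p
  dia-⋆-closed {x} {y} p y≤x = begin
    dia y (fdia (x ⋆) p)  ≡⟨ sym (dia-comp y (x ⋆) p) ⟩
    dia (y · x ⋆) p       ≤⟨ dia-monoˡ p (≤-trans (·-monoˡ (x ⋆) y≤x) (x⋆≤⋆ x)) ⟩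
    dia (x ⋆) p           ∎
    where open ≤-Reasoning

  invariant-commutes : ∀ x s → dia x s ≤ ⌊ s ⌋ → ¬ₜ s · x ≤ x · ¬ₜ s
  invariant-commutes x s xs≤s = begin
    ¬ₜ s · x                              ≡⟨ splitʳ s (¬ₜ s · x) ⟩
    ¬ₜ s · x · ⌊ s ⌋ + ¬ₜ s · x · ¬ₜ s    ≡⟨ cong (_+ ¬ₜ s · x · ¬ₜ s) (≤0⇒≡0 (dia-galois⇒ x s s xs≤s)) ⟩
    0# + ¬ₜ s · x · ¬ₜ s                  ≡⟨ trans (+-identityˡ _) (·-assoc (¬ₜ s) x (¬ₜ s)) ⟩
    ¬ₜ s · (x · ¬ₜ s)                     ≤⟨ ·-decreasingˡ (x · ¬ₜ s) (¬test≤1 s) ⟩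
    x · ¬ₜ s                              ∎
    where open ≤-Reasoning

  dia-⋆-induct : ∀ x p s → ⌊ p ⌋ ≤ ⌊ s ⌋ → dia x s ≤ ⌊ s ⌋ → dia (x ⋆) p ≤ ⌊ s ⌋
  dia-⋆-induct x p s p≤s xs≤s = dia-galois⇐ (x ⋆) p s (begin
    ¬ₜ s · x ⋆ · ⌊ p ⌋     ≤⟨ ·-monoˡ ⌊ p ⌋ (⋆-simulation x (¬ₜ s) (invariant-commutes x s xs≤s)) ⟩
    x ⋆ · ¬ₜ s · ⌊ p ⌋     ≡⟨ ·-assoc (x ⋆) (¬ₜ s) ⌊ p ⌋ ⟩
    x ⋆ · (¬ₜ s · ⌊ p ⌋)   ≡⟨ cong (x ⋆ ·_) (≤0⇒≡0 (annihilateˡ s p≤s)) ⟩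
    x ⋆ · 0#               ≡⟨ zeroʳ (x ⋆) ⟩
    0#                     ∎)
    where open ≤-Reasoning

  dia-⋆-idem : ∀ x p → dia (x ⋆) (fdia (x ⋆) p) ≤ dia (x ⋆) p
  dia-⋆-idem x p = dia-⋆-induct x (fdia (x ⋆) p) (fdia (x ⋆) p) ≤-refl (dia-⋆-closed p ≤-refl)

  -- Noetherian induction: if q ≤ r + |a⟩q and r is |a⟩-closed then q ≤ r.
  -- The test t = q - r satisfies t ≤ |a⟩t, so it vanishes.
  noetherian-induction : ∀ a → Noetherian a → (q r : Test) →
    ⌊ q ⌋ ≤ ⌊ r ⌋ + dia a q → dia a r ≤ ⌊ r ⌋ → ⌊ q ⌋ ≤ ⌊ r ⌋
  noetherian-induction a noetherian q r q≤r+aq ar≤r =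
    below-testʳ r (test≤1 q) (noetherian t (annihilateʳ (fdia a t) t≤at))
    where
    t = q ∖ r
    aq≤at+r : dia a q ≤ dia a t + ⌊ r ⌋
    aq≤at+r = ≤-trans (dia-monoʳ a (test-split q r))
      (dia-⊕-lub a t r (fdia a t ⊕ r) (x≤x+y _ _) (≤-trans ar≤r (y≤x+y _ _)))
    t≤at : ⌊ t ⌋ ≤ dia a t
    t≤at = complement-shift r (≤-trans q≤r+aq (+-lub (y≤x+y _ _) aq≤at+r))

  module Commutation (a b : Carrier) where
    open ≤-Reasoning

    C : Test → Test
    C = fdia ((a + b) ⋆)

    a-closed : ∀ p → dia a (C p) ≤ ⌊ C p ⌋
    a-closed p = dia-⋆-closed p (x≤x+y a b)

    b⋆≤C : ∀ p → dia (b ⋆) p ≤ ⌊ C p ⌋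
    b⋆≤C p = dia-⋆-induct b p (C p) (dia-⋆-refl (a + b) p) (dia-⋆-closed p (y≤x+y a b))

    a⋆b⋆≤C : ∀ p → dia (a ⋆) (fdia (b ⋆) p) ≤ ⌊ C p ⌋
    a⋆b⋆≤C p = dia-⋆-induct a (fdia (b ⋆) p) (C p) (b⋆≤C p) (a-closed p)

    locally⇒quasi : LocallyDSemiCommutes a b → DQuasiCommutes a b
    locally⇒quasi local p = begin
      dia b (fdia a p)                      ≤⟨ local p ⟩
      dia (a ⁺) (fdia (b ⋆) p)              ≡⟨ dia-comp a (a ⋆) _ ⟩
      dia a (fdia (a ⋆) (fdia (b ⋆) p))     ≤⟨ dia-monoʳ a (a⋆b⋆≤C p) ⟩
      dia a (C p)                           ∎

    semi⇒locally : DSemiCommutes a b → LocallyDSemiCommutes a b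
    semi⇒locally semi p = ≤-trans (dia-monoˡ (fdia a p) (x≤⋆ b)) (semi p)

    module FromQuasi (quasi : DQuasiCommutes a b) where

      quasi-⋆ : ∀ p → dia (b ⋆) (fdia a p) ≤ dia a (C p)
      quasi-⋆ p = dia-⋆-induct b (fdia a p) (fdia a (C p))
        (dia-monoʳ a (dia-⋆-refl (a + b) p))
        (begin
          dia b (fdia a (C p))           ≤⟨ quasi (C p) ⟩
          dia a (fdia ((a + b) ⋆) (C p)) ≤⟨ dia-monoʳ a (dia-⋆-idem (a + b) p) ⟩
          dia a (C p)                    ∎)

      C-unfold : ∀ p → ⌊ C p ⌋ ≤ dia (b ⋆) p + dia a (C p)
      C-unfold p = dia-⋆-induct (a + b) p s
        (≤-trans (dia-⋆-refl b p) (x≤x+y _ _))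
        (dia-+-lub a b s s
          (dia-⊕-lub a B A s (≤-trans (dia-monoʳ a (b⋆≤C p)) (y≤x+y _ _))
                             (≤-trans (dia-monoʳ a (a-closed p)) (y≤x+y _ _)))
          (dia-⊕-lub b B A s (≤-trans (dia-⋆-closed p ≤-refl) (x≤x+y _ _))
                             (≤-trans (quasi (C p))
                               (≤-trans (dia-monoʳ a (dia-⋆-idem (a + b) p)) (y≤x+y _ _)))))
        where
        B = fdia (b ⋆) p
        A = fdia a (C p)
        s = B ⊕ A

      C≤a⋆b⋆ : Noetherian a → ∀ p → ⌊ C p ⌋ ≤ dia (a ⋆) (fdia (b ⋆) p)
      C≤a⋆b⋆ noetherian p = noetherian-induction a noetherian (C p) (fdia (a ⋆) (fdia (b ⋆) p))
        (≤-trans (C-unfold p) (+-mono (dia-⋆-refl a (fdia (b ⋆) p)) ≤-refl))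
        (dia-⋆-closed (fdia (b ⋆) p) ≤-refl)

      semi : Noetherian a → DSemiCommutes a b
      semi noetherian p = begin
        dia (b ⋆) (fdia a p)                  ≤⟨ quasi-⋆ p ⟩
        dia a (C p)                           ≤⟨ dia-monoʳ a (C≤a⋆b⋆ noetherian p) ⟩
        dia a (fdia (a ⋆) (fdia (b ⋆) p))     ≡⟨ sym (dia-comp a (a ⋆) _) ⟩
        dia (a ⁺) (fdia (b ⋆) p)              ∎

    quasi⇒semi : Noetherian a → DQuasiCommutes a b → DSemiCommutes a b
    quasi⇒semi noetherian quasi = FromQuasi.semi quasi noetherian

lemma10p4 : ∀ {c : Level} (S : ModalKleeneAlgebra c) →
    let open ModalKleeneAlgebra S in
    ∀ (a b : Carrier) → Noetherian a →
      (LocallyDSemiCommutes a b ⇔ DSemiCommutes a b) ×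
      (DSemiCommutes a b ⇔ DQuasiCommutes a b)
lemma10p4 S a b noetherian =
  ( (λ local → quasi⇒semi noetherian (locally⇒quasi local)) , semi⇒locally )
  , ( (λ semi → locally⇒quasi (semi⇒locally semi)) , quasi⇒semi noetherian )
  where open Properties.Commutation S a b
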